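{- Let $k\ge 2$ be an integer, and let $G$ be a graph with a spanning subgraph $F$. If $\beta^k(G) \ge 1$ and the maximum degree satisfies $\Delta(F) \le k-2$, then $\beta^2(G - E(F)) \ge 1$.
   Context: All graphs are finite and simple; $G-E(F)$ is the graph on $V(G)$ with edge set $E(G)\setminus E(F)$. For a positive integer $j$ and $S\subseteq V(H)$, $\Lambda^j_H(S)$ is the set of vertices of $H$ with at least $j$ neighbors in $S$, and $\beta^j(H)=\min\{|\Lambda^j_H(S)|/|S| : S\subseteq V(H),\ |S|\ge j,\ \Lambda^j_H(S)\ne V(H)\}$, with $\beta^j(H)=0$ if $|V(H)|<j$. -}

module Defs where

open import Data.Nat using (ℕ; _≤_; _∸_)
open import Data.Bool using (Bool; true; false; _∧_; not)
open import Data.Fin using (Fin)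
open import Data.Fin.Subset using (Subset; ∣_∣; _∩_; ⊤)
open import Data.Vec using (tabulate)
open import Relation.Binary.PropositionalEquality using (_≡_; _≢_)

record Graph (n : ℕ) : Set where
  field
    adj   : Fin n → Fin n → Bool
    sym   : ∀ u v → adj u v ≡ adj v u
    irrefl : ∀ u → adj u u ≡ false
open Graph public

N : ∀ {n} → Graph n → Fin n → Subset n
N H u = tabulate (adj H u)

deg : ∀ {n} → Graph n → Fin n → ℕ
deg H u = ∣ N H u ∣

MaxDeg≤ : ∀ {n} → Graph n → ℕ → Set
MaxDeg≤ H d = ∀ u → deg H u ≤ d

SpanningSubgraph : ∀ {n} → Graph n → Graph n → Set
SpanningSubgraph F G = ∀ u v → adj F u v ≡ true → adj G u v ≡ true

_-E_ : ∀ {n} → Graph n → Graph n → Graph n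
adj (G -E F) u v = adj G u v ∧ not (adj F u v)
sym (G -E F) u v rewrite sym G u v | sym F u v = _≡_.refl
irrefl (G -E F) u rewrite irrefl G u = _≡_.refl

Λ : ∀ {n} → ℕ → Graph n → Subset n → Subset n
Λ j H S = tabulate (λ u → isYes (j ≤? ∣ S ∩ N H u ∣))
  where
    open import Data.Nat using (_≤?_)
    open import Relation.Nullary.Decidable using (isYes)

-- β^j(H) ≥ 1.  By definition β^j(H) = 0 if |V(H)| < j, and otherwise
-- β^j(H) = min { |Λ^j_H(S)| / |S| : |S| ≥ j, Λ^j_H(S) ≠ V(H) }
-- (this index set is nonempty when |V(H)| ≥ j ≥ 1).  Hence
-- β^j(H) ≥ 1 unfolds to: |V(H)| ≥ j and every admissible S has
-- |Λ^j_H(S)| / |S| ≥ 1, i.e. |S| ≤ |Λ^j_H(S)| (note |S| ≥ j ≥ 1 > 0).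
β≥1 : ∀ {n} → ℕ → Graph n → Set
β≥1 {n} j H =
  (j ≤ n) Data.Product.×
  (∀ (S : Subset n) → j ≤ ∣ S ∣ → Λ j H S ≢ ⊤ → ∣ S ∣ ≤ ∣ Λ j H S ∣)
  where import Data.Product

{-# OPTIONS --safe #-}
-- Write G′ = G - E(F); passing from G to G′ costs every vertex at most k - 2 neighbours.
-- If |S| ≥ k, a vertex with k neighbours in S keeps two of them, so Λᵏ_G(S) ⊆ Λ²_G′(S) and
-- β^k(G) ≥ 1 applies directly.  For a k-set X, Λᵏ_G(X) is the set of common neighbours of X,
-- none of which lies in X; applied to a k-set X ⊇ {a, b} containing as many common neighbours
-- of a and b as possible, β^k(G) ≥ 1 gives every two vertices at least 2k - 2 common neighbours.
-- If 2 ≤ s = |S| < k and |Λ²_G′(S)| < s, count the cherries a – u – b with a ≠ b in S and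
-- centre u ∉ Λ²_G′(S): each of the s(s - 1) ordered pairs has at least 2k - 1 - s centres,
-- while a centre has at most one G′-neighbour in S and so lies on at most s·|S ∩ N_F(u)|
-- cherries, at most s²(k - 2) in total.  But s(s - 1)(2k - 1 - s) > s²(k - 2).
module Submission where

open import Defs
open import Data.Nat using (ℕ; _≤_; _∸_)

open import Data.Nat using (zero; suc; _+_; _*_; _<_; z≤n; s≤s; s≤s⁻¹; _≤?_)
open import Data.Nat.Properties hiding (_≟_)
open import Data.Nat.Tactic.RingSolver using (solve-∀)
open import Algebra.Properties.Semiring.Sum +-*-semiring
  using (sum; sum-syntax; sum-cong-≗; sum-replicate-zero; ∑-comm; ∑-distrib-+; *-distribˡ-sum; *-distribʳ-sum)
open import Data.Bool using (Bool; true; false; _∧_; not; T)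
open import Data.Bool.Properties using (∧-assoc; ∧-identityʳ; ∧-zeroʳ; T-≡)
open import Data.Fin using (Fin; zero; suc; _≟_)
open import Data.Fin.Subset using (Subset; ∣_∣; _∩_; _∪_; ∁; ⁅_⁆; ⊤; _∈_; _∉_; _⊆_) renaming (⊥ to ∅)
open import Data.Fin.Subset.Properties
open import Data.Vec using ([]; _∷_; here; lookup; tabulate)
open import Data.Vec.Properties using (lookup∘tabulate; lookup-zipWith; []=⇒lookup; lookup⇒[]=)
open import Data.Product using (∃-syntax; _×_; _,_; proj₁)
open import Data.Sum using (inj₁; inj₂)
open import Data.Unit using (tt)
open import Function using (_∘_; id; Equivalence)
open import Relation.Nullary using (¬_; Dec; does; yes; no; contradiction)
open import Relation.Nullary.Decidable using (toWitness; fromWitness)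
open import Relation.Binary.PropositionalEquality as ≡ using (_≡_; refl; cong; cong₂; subst; _≢_; module ≡-Reasoning)

[_] : Bool → ℕ
[ false ] = 0
[ true  ] = 1

[∧] : ∀ x y → [ x ∧ y ] ≡ [ x ] * [ y ]
[∧] false y = refl
[∧] true  y = ≡.sym (+-identityʳ [ y ])

[]-split : ∀ x y → [ x ] ≡ [ x ∧ y ] + [ x ∧ not y ]
[]-split false y     = refl
[]-split true  false = refl
[]-split true  true  = refl

[]*-≤ : ∀ {b x y} → (T b → x ≤ y) → [ b ] * x ≤ y
[]*-≤ {false} _   = z≤n
[]*-≤ {true}  {x} x≤y = ≤-trans (≤-reflexive (+-identityʳ x)) (x≤y tt)

[]*∸[] : ∀ x m → [ x ] * (m ∸ [ x ]) ≡ [ x ] * (m ∸ 1)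
[]*∸[] false m = refl
[]*∸[] true  m = refl

[]-rearrange : ∀ x₁ x₂ e y₁ y₂ z →
  [ x₁ ∧ (x₂ ∧ e) ] * [ (y₁ ∧ y₂) ∧ z ] ≡ [ z ] * [ (x₁ ∧ y₁) ∧ ((x₂ ∧ y₂) ∧ e) ]
[]-rearrange x₁ x₂ e y₁ y₂ z
  rewrite [∧] x₁ (x₂ ∧ e) | [∧] x₂ e | [∧] (y₁ ∧ y₂) z | [∧] y₁ y₂
        | [∧] (x₁ ∧ y₁) ((x₂ ∧ y₂) ∧ e) | [∧] x₁ y₁ | [∧] (x₂ ∧ y₂) e | [∧] x₂ y₂
  = *-rearrange [ x₁ ] [ x₂ ] [ e ] [ y₁ ] [ y₂ ] [ z ]
  where
    *-rearrange : ∀ a b c d e f → a * (b * c) * (d * e * f) ≡ f * (a * d * (b * e * c))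
    *-rearrange = solve-∀

sum-mono-≤ : ∀ {n} {f g : Fin n → ℕ} → (∀ i → f i ≤ g i) → sum f ≤ sum g
sum-mono-≤ {zero}  _   = z≤n
sum-mono-≤ {suc n} f≤g = +-mono-≤ (f≤g zero) (sum-mono-≤ (f≤g ∘ suc))

∑-[≟] : ∀ {n} (p : Fin n → Bool) a → ∑[ i < n ] [ p i ∧ does (i ≟ a) ] ≡ [ p a ]
∑-[≟] {suc n} p zero = begin
  [ p zero ∧ true ] + ∑[ i < n ] [ p (suc i) ∧ false ]
    ≡⟨ cong₂ _+_ (cong [_] (∧-identityʳ (p zero))) (sum-cong-≗ (cong [_] ∘ ∧-zeroʳ ∘ p ∘ suc)) ⟩
  [ p zero ] + ∑[ i < n ] 0
    ≡⟨ cong ([ p zero ] +_) (sum-replicate-zero n) ⟩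
  [ p zero ] + 0
    ≡⟨ +-identityʳ [ p zero ] ⟩
  [ p zero ] ∎
  where open ≡-Reasoning
∑-[≟] {suc n} p (suc a) =
  cong₂ _+_ (cong [_] (∧-zeroʳ (p zero))) (∑-[≟] {n} (p ∘ suc) a)

∑-[]-split : ∀ {n} (p q : Fin n → Bool) →
  ∑[ i < n ] [ p i ] ≡ ∑[ i < n ] [ p i ∧ q i ] + ∑[ i < n ] [ p i ∧ not (q i) ]
∑-[]-split p q = ≡.trans (sum-cong-≗ λ i → []-split (p i) (q i))
                         (∑-distrib-+ (λ i → [ p i ∧ q i ]) (λ i → [ p i ∧ not (q i) ]))

∣∣≡∑ : ∀ {n} (p : Subset n) → ∣ p ∣ ≡ ∑[ i < n ] [ lookup p i ]
∣∣≡∑ []          = refl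
∣∣≡∑ (false ∷ p) = ∣∣≡∑ p
∣∣≡∑ (true  ∷ p) = cong suc (∣∣≡∑ p)

lookup-∩ : ∀ {n} (p q : Subset n) i → lookup (p ∩ q) i ≡ lookup p i ∧ lookup q i
lookup-∩ p q i = lookup-zipWith _∧_ i p q

T-lookup⇒∈ : ∀ {n} {p : Subset n} {x} → T (lookup p x) → x ∈ p
T-lookup⇒∈ {p = p} {x} h = lookup⇒[]= x p (Equivalence.to T-≡ h)

∣p∣≡∣p∩q∣+∣p∩∁q∣ : ∀ {n} (p q : Subset n) → ∣ p ∣ ≡ ∣ p ∩ q ∣ + ∣ p ∩ ∁ q ∣
∣p∣≡∣p∩q∣+∣p∩∁q∣ []          []          = refl
∣p∣≡∣p∩q∣+∣p∩∁q∣ (false ∷ p) (_     ∷ q) = ∣p∣≡∣p∩q∣+∣p∩∁q∣ p q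
∣p∣≡∣p∩q∣+∣p∩∁q∣ (true  ∷ p) (true  ∷ q) = cong suc (∣p∣≡∣p∩q∣+∣p∩∁q∣ p q)
∣p∣≡∣p∩q∣+∣p∩∁q∣ (true  ∷ p) (false ∷ q) =
  ≡.trans (cong suc (∣p∣≡∣p∩q∣+∣p∩∁q∣ p q)) (≡.sym (+-suc _ _))

∣p∣≤∣p∩∁q∣+∣q∣ : ∀ {n} (p q : Subset n) → ∣ p ∣ ≤ ∣ p ∩ ∁ q ∣ + ∣ q ∣
∣p∣≤∣p∩∁q∣+∣q∣ p q = begin
  ∣ p ∣                      ≡⟨ ∣p∣≡∣p∩q∣+∣p∩∁q∣ p q ⟩
  ∣ p ∩ q ∣ + ∣ p ∩ ∁ q ∣    ≤⟨ +-monoˡ-≤ _ (∣p∩q∣≤∣q∣ p q) ⟩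
  ∣ q ∣ + ∣ p ∩ ∁ q ∣        ≡⟨ +-comm ∣ q ∣ _ ⟩
  ∣ p ∩ ∁ q ∣ + ∣ q ∣        ∎
  where open ≤-Reasoning

∣p∪q∣≤∣p∣+∣q∣ : ∀ {n} (p q : Subset n) → ∣ p ∪ q ∣ ≤ ∣ p ∣ + ∣ q ∣
∣p∪q∣≤∣p∣+∣q∣ []          []          = z≤n
∣p∪q∣≤∣p∣+∣q∣ (true  ∷ p) (y     ∷ q) = s≤s (≤-trans (∣p∪q∣≤∣p∣+∣q∣ p q) (+-monoʳ-≤ ∣ p ∣ (∣p∣≤∣x∷p∣ y q)))
∣p∪q∣≤∣p∣+∣q∣ (false ∷ p) (false ∷ q) = ∣p∪q∣≤∣p∣+∣q∣ p q
∣p∪q∣≤∣p∣+∣q∣ (false ∷ p) (true  ∷ q) = ≤-trans (s≤s (∣p∪q∣≤∣p∣+∣q∣ p q)) (≤-reflexive (≡.sym (+-suc ∣ p ∣ ∣ q ∣)))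

∣p∣≤∣p∩q∣⇒p⊆q : ∀ {n} {p q : Subset n} → ∣ p ∣ ≤ ∣ p ∩ q ∣ → p ⊆ q
∣p∣≤∣p∩q∣⇒p⊆q {p = p} {q} ∣p∣≤∣p∩q∣ {x} x∈p with x ∈? q
... | yes x∈q = x∈q
... | no  x∉q = contradiction ∣p∣≤∣p∩q∣ (<⇒≱ (begin-strict
  ∣ p ∩ q ∣                    <⟨ m<m+n ∣ p ∩ q ∣ ∣p∩∁q∣>0 ⟩
  ∣ p ∩ q ∣ + ∣ p ∩ ∁ q ∣      ≡⟨ ∣p∣≡∣p∩q∣+∣p∩∁q∣ p q ⟨
  ∣ p ∣                        ∎))
  where
    open ≤-Reasoning
    ∣p∩∁q∣>0 : 0 < ∣ p ∩ ∁ q ∣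
    ∣p∩∁q∣>0 = ≤-trans (s≤s z≤n) (x∈p⇒∣p-x∣<∣p∣ (x∈p∩q⁺ (x∈p , x∉p⇒x∈∁p x∉q)))

intermediate-subset : ∀ {n} {p q : Subset n} {m} → p ⊆ q → ∣ p ∣ ≤ m → m ≤ ∣ q ∣ →
          ∃[ r ] p ⊆ r × r ⊆ q × ∣ r ∣ ≡ m
intermediate-subset {p = []} {[]} _ _ z≤n = [] , id , id , refl
intermediate-subset {p = true ∷ p} {false ∷ q} p⊆q _ _ = contradiction (p⊆q here) λ ()
intermediate-subset {p = true ∷ p} {true ∷ q} p⊆q (s≤s ∣p∣≤m) (s≤s m≤∣q∣)
  with r , p⊆r , r⊆q , ∣r∣≡m ← intermediate-subset (drop-∷-⊆ p⊆q) ∣p∣≤m m≤∣q∣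
  = true ∷ r , s⊆s p⊆r , s⊆s r⊆q , cong suc ∣r∣≡m
intermediate-subset {p = false ∷ p} {false ∷ q} p⊆q ∣p∣≤m m≤∣q∣
  with r , p⊆r , r⊆q , ∣r∣≡m ← intermediate-subset (drop-∷-⊆ p⊆q) ∣p∣≤m m≤∣q∣
  = false ∷ r , s⊆s p⊆r , s⊆s r⊆q , ∣r∣≡m
intermediate-subset {p = false ∷ p} {true ∷ q} {m} p⊆q ∣p∣≤m m≤1+∣q∣ with m ≤? ∣ q ∣
... | yes m≤∣q∣
  with r , p⊆r , r⊆q , ∣r∣≡m ← intermediate-subset (drop-∷-⊆ p⊆q) ∣p∣≤m m≤∣q∣
  = false ∷ r , s⊆s p⊆r , out⊆ r⊆q , ∣r∣≡m
... | no m≰∣q∣ with ≰⇒> m≰∣q∣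
...   | s≤s ∣q∣≤m′
  with r , p⊆r , r⊆q , ∣r∣≡m′ ← intermediate-subset (drop-∷-⊆ p⊆q)
                                   (≤-trans (p⊆q⇒∣p∣≤∣q∣ (drop-∷-⊆ p⊆q)) ∣q∣≤m′) (s≤s⁻¹ m≤1+∣q∣)
  = true ∷ r , out⊆ p⊆r , s⊆s r⊆q , cong suc ∣r∣≡m′

module _ {n} (H : Graph n) where

  lookup-N : ∀ u v → lookup (N H u) v ≡ adj H u v
  lookup-N u = lookup∘tabulate (adj H u)

  lookup-N-sym : ∀ u v → lookup (N H u) v ≡ lookup (N H v) u
  lookup-N-sym u v = ≡.trans (lookup-N u v) (≡.trans (sym H u v) (≡.sym (lookup-N v u)))

  ∈N-sym : ∀ {u v} → v ∈ N H u → u ∈ N H v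
  ∈N-sym {u} {v} v∈N = lookup⇒[]= u (N H v) (≡.trans (≡.sym (lookup-N-sym u v)) ([]=⇒lookup v∈N))

  ∉N-self : ∀ {u} → u ∉ N H u
  ∉N-self {u} u∈N with () ← ≡.trans (≡.sym ([]=⇒lookup u∈N)) (≡.trans (lookup-N u u) (irrefl H u))

  ∣∩N∣≡∑ : ∀ (S : Subset n) u → ∣ S ∩ N H u ∣ ≡ ∑[ a < n ] [ lookup S a ∧ adj H u a ]
  ∣∩N∣≡∑ S u = ≡.trans (∣∣≡∑ (S ∩ N H u))
    (sum-cong-≗ λ a → cong [_] (≡.trans (lookup-∩ S (N H u) a) (cong (lookup S a ∧_) (lookup-N u a))))

  ∈Λ⇒ : ∀ j S {u} → u ∈ Λ j H S → j ≤ ∣ S ∩ N H u ∣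
  ∈Λ⇒ j S {u} u∈Λ = toWitness (subst T (≡.trans (≡.sym ([]=⇒lookup u∈Λ)) (lookup∘tabulate _ u)) tt)

  ∈Λ⇐ : ∀ j S {u} → j ≤ ∣ S ∩ N H u ∣ → u ∈ Λ j H S
  ∈Λ⇐ j S {u} j≤ = lookup⇒[]= u _ (≡.trans (lookup∘tabulate _ u) (Equivalence.to T-≡ (fromWitness j≤)))

  ∑∣S∩N∣≤∣S∣*Δ : ∀ {d} → MaxDeg≤ H d → (S : Subset n) → ∑[ u < n ] ∣ S ∩ N H u ∣ ≤ ∣ S ∣ * d
  ∑∣S∩N∣≤∣S∣*Δ {d} Δ≤d S = begin
    ∑[ u < n ] ∣ S ∩ N H u ∣
      ≡⟨ sum-cong-≗ (∣∣≡∑ ∘ (S ∩_) ∘ N H) ⟩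
    ∑[ u < n ] ∑[ a < n ] [ lookup (S ∩ N H u) a ]
      ≡⟨ ∑-comm (λ u a → [ lookup (S ∩ N H u) a ]) ⟩
    ∑[ a < n ] ∑[ u < n ] [ lookup (S ∩ N H u) a ]
      ≡⟨ sum-cong-≗ (λ a → sum-cong-≗ λ u → lookup-S∩N a u) ⟩
    ∑[ a < n ] ∑[ u < n ] ([ lookup S a ] * [ lookup (N H a) u ])
      ≡⟨ sum-cong-≗ (λ a → *-distribˡ-sum [ lookup S a ] (λ u → [ lookup (N H a) u ])) ⟨
    ∑[ a < n ] ([ lookup S a ] * ∑[ u < n ] [ lookup (N H a) u ])
      ≡⟨ sum-cong-≗ (λ a → cong ([ lookup S a ] *_) (∣∣≡∑ (N H a))) ⟨
    ∑[ a < n ] ([ lookup S a ] * deg H a)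
      ≤⟨ sum-mono-≤ (λ a → *-monoʳ-≤ [ lookup S a ] (Δ≤d a)) ⟩
    ∑[ a < n ] ([ lookup S a ] * d)
      ≡⟨ *-distribʳ-sum d (λ a → [ lookup S a ]) ⟨
    (∑[ a < n ] [ lookup S a ]) * d
      ≡⟨ cong (_* d) (∣∣≡∑ S) ⟨
    ∣ S ∣ * d ∎
    where
      open ≤-Reasoning
      lookup-S∩N : ∀ a u → [ lookup (S ∩ N H u) a ] ≡ [ lookup S a ] * [ lookup (N H a) u ]
      lookup-S∩N a u =
        ≡.trans (cong [_] (≡.trans (lookup-∩ S (N H u) a) (cong (lookup S a ∧_) (lookup-N-sym u a))))
                ([∧] (lookup S a) (lookup (N H a) u))

distinctIn : ∀ {n} → Subset n → Fin n → Fin n → Bool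
distinctIn S a b = lookup S a ∧ (lookup S b ∧ not (does (b ≟ a)))

∑-[≢] : ∀ {n} (S : Subset n) a → ∑[ b < n ] [ lookup S b ∧ not (does (b ≟ a)) ] ≡ ∣ S ∣ ∸ [ lookup S a ]
∑-[≢] {n} S a = begin
  ∑[ b < n ] [ S≢a b ]                                   ≡⟨ m+n∸m≡n [ lookup S a ] _ ⟨
  [ lookup S a ] + ∑[ b < n ] [ S≢a b ] ∸ [ lookup S a ]  ≡⟨ cong (_∸ [ lookup S a ]) ∣S∣-split ⟨
  ∣ S ∣ ∸ [ lookup S a ]                                 ∎
  where
    open ≡-Reasoning
    S≢a : Fin n → Bool
    S≢a b = lookup S b ∧ not (does (b ≟ a))
    ∣S∣-split : ∣ S ∣ ≡ [ lookup S a ] + ∑[ b < n ] [ S≢a b ]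
    ∣S∣-split = begin
      ∣ S ∣                                                            ≡⟨ ∣∣≡∑ S ⟩
      ∑[ b < n ] [ lookup S b ]                                        ≡⟨ ∑-[]-split (lookup S) (λ b → does (b ≟ a)) ⟩
      ∑[ b < n ] [ lookup S b ∧ does (b ≟ a) ] + ∑[ b < n ] [ S≢a b ]  ≡⟨ cong (_+ ∑[ b < n ] [ S≢a b ]) (∑-[≟] (lookup S) a) ⟩
      [ lookup S a ] + ∑[ b < n ] [ S≢a b ]                            ∎

∑∑-distinctIn : ∀ {n} (S : Subset n) → ∑[ a < n ] ∑[ b < n ] [ distinctIn S a b ] ≡ ∣ S ∣ * (∣ S ∣ ∸ 1)
∑∑-distinctIn {n} S = begin
  ∑[ a < n ] ∑[ b < n ] [ distinctIn S a b ]
    ≡⟨ sum-cong-≗ (λ a → sum-cong-≗ λ b → [∧] (lookup S a) (lookup S b ∧ not (does (b ≟ a)))) ⟩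
  ∑[ a < n ] ∑[ b < n ] ([ lookup S a ] * [ lookup S b ∧ not (does (b ≟ a)) ])
    ≡⟨ sum-cong-≗ (λ a → *-distribˡ-sum [ lookup S a ] (λ b → [ lookup S b ∧ not (does (b ≟ a)) ])) ⟨
  ∑[ a < n ] ([ lookup S a ] * ∑[ b < n ] [ lookup S b ∧ not (does (b ≟ a)) ])
    ≡⟨ sum-cong-≗ (λ a → ≡.trans (cong ([ lookup S a ] *_) (∑-[≢] S a)) ([]*∸[] (lookup S a) ∣ S ∣)) ⟩
  ∑[ a < n ] ([ lookup S a ] * (∣ S ∣ ∸ 1))
    ≡⟨ *-distribʳ-sum (∣ S ∣ ∸ 1) (λ a → [ lookup S a ]) ⟨
  (∑[ a < n ] [ lookup S a ]) * (∣ S ∣ ∸ 1)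
    ≡⟨ cong (_* (∣ S ∣ ∸ 1)) (∣∣≡∑ S) ⟨
  ∣ S ∣ * (∣ S ∣ ∸ 1) ∎
  where open ≡-Reasoning

-- Both sides count the cherries a – u – b with a ≠ b in S and u ∈ R: by their ends, and by their centre.
cherry-count : ∀ {n} (H : Graph n) (S R : Subset n) →
  ∑[ a < n ] ∑[ b < n ] ([ distinctIn S a b ] * ∣ (N H a ∩ N H b) ∩ R ∣) ≡
  ∑[ u < n ] ([ lookup R u ] * (∣ S ∩ N H u ∣ * (∣ S ∩ N H u ∣ ∸ 1)))
cherry-count {n} H S R = begin
  ∑[ a < n ] ∑[ b < n ] ([ distinctIn S a b ] * ∣ (N H a ∩ N H b) ∩ R ∣)
    ≡⟨ sum-cong-≗ (λ a → sum-cong-≗ λ b →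
         ≡.trans (cong ([ distinctIn S a b ] *_) (∣∣≡∑ ((N H a ∩ N H b) ∩ R)))
                 (*-distribˡ-sum [ distinctIn S a b ] (λ u → [ lookup ((N H a ∩ N H b) ∩ R) u ]))) ⟩
  ∑[ a < n ] ∑[ b < n ] ∑[ u < n ] cherry a b u  ≡⟨ sum-cong-≗ (λ a → ∑-comm (cherry a)) ⟩
  ∑[ a < n ] ∑[ u < n ] ∑[ b < n ] cherry a b u  ≡⟨ ∑-comm (λ a u → ∑[ b < n ] cherry a b u) ⟩
  ∑[ u < n ] ∑[ a < n ] ∑[ b < n ] cherry a b u
    ≡⟨ sum-cong-≗ (λ u → sum-cong-≗ λ a → sum-cong-≗ λ b → by-centre u a b) ⟩
  ∑[ u < n ] ∑[ a < n ] ∑[ b < n ] ([ lookup R u ] * [ distinctIn (S ∩ N H u) a b ])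
    ≡⟨ sum-cong-≗ (λ u → ≡.trans (*-distribˡ-sum [ lookup R u ] (λ a → ∑[ b < n ] [ distinctIn (S ∩ N H u) a b ]))
                                  (sum-cong-≗ λ a → *-distribˡ-sum [ lookup R u ] (λ b → [ distinctIn (S ∩ N H u) a b ]))) ⟨
  ∑[ u < n ] ([ lookup R u ] * ∑[ a < n ] ∑[ b < n ] [ distinctIn (S ∩ N H u) a b ])
    ≡⟨ sum-cong-≗ (λ u → cong ([ lookup R u ] *_) (∑∑-distinctIn (S ∩ N H u))) ⟩
  ∑[ u < n ] ([ lookup R u ] * (∣ S ∩ N H u ∣ * (∣ S ∩ N H u ∣ ∸ 1))) ∎
  where
    open ≡-Reasoning
    cherry : Fin n → Fin n → Fin n → ℕ
    cherry a b u = [ distinctIn S a b ] * [ lookup ((N H a ∩ N H b) ∩ R) u ]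
    by-centre : ∀ u a b → cherry a b u ≡ [ lookup R u ] * [ distinctIn (S ∩ N H u) a b ]
    by-centre u a b
      rewrite lookup-∩ (N H a ∩ N H b) R u | lookup-∩ (N H a) (N H b) u
            | lookup-N-sym H a u | lookup-N-sym H b u
            | lookup-∩ S (N H u) a | lookup-∩ S (N H u) b
      = []-rearrange (lookup S a) (lookup S b) (not (does (b ≟ a)))
                     (lookup (N H u) a) (lookup (N H u) b) (lookup R u)

module _ {n} {G F : Graph n} (F⊆G : SpanningSubgraph F G) where

  ∣S∩N∣-split : ∀ (S : Subset n) u → ∣ S ∩ N G u ∣ ≡ ∣ S ∩ N F u ∣ + ∣ S ∩ N (G -E F) u ∣
  ∣S∩N∣-split S u = begin
    ∣ S ∩ N G u ∣
      ≡⟨ ∣∩N∣≡∑ G S u ⟩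
    ∑[ a < n ] [ lookup S a ∧ adj G u a ]
      ≡⟨ ∑-[]-split (λ a → lookup S a ∧ adj G u a) (adj F u) ⟩
    ∑[ a < n ] [ (lookup S a ∧ adj G u a) ∧ adj F u a ] + ∑[ a < n ] [ (lookup S a ∧ adj G u a) ∧ not (adj F u a) ]
      ≡⟨ cong₂ _+_ (sum-cong-≗ λ a → cong [_] (∧-absorb (lookup S a) (F⊆G u a)))
                   (sum-cong-≗ λ a → cong [_] (∧-assoc (lookup S a) (adj G u a) (not (adj F u a)))) ⟩
    ∑[ a < n ] [ lookup S a ∧ adj F u a ] + ∑[ a < n ] [ lookup S a ∧ adj (G -E F) u a ]
      ≡⟨ cong₂ _+_ (∣∩N∣≡∑ F S u) (∣∩N∣≡∑ (G -E F) S u) ⟨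
    ∣ S ∩ N F u ∣ + ∣ S ∩ N (G -E F) u ∣ ∎
    where
      open ≡-Reasoning
      ∧-absorb : ∀ x {y z} → (z ≡ true → y ≡ true) → (x ∧ y) ∧ z ≡ x ∧ z
      ∧-absorb false _ = refl
      ∧-absorb true {y} {false} _ = ∧-zeroʳ y
      ∧-absorb true {y} {true} z⇒y = ≡.trans (∧-identityʳ y) (z⇒y refl)

  neighbours-after-removal : ∀ {d j} → MaxDeg≤ F d → ∀ S {u} → j + d ≤ ∣ S ∩ N G u ∣ → j ≤ ∣ S ∩ N (G -E F) u ∣
  neighbours-after-removal {d} {j} Δ≤d S {u} j+d≤ = +-cancelʳ-≤ d j _ (begin
    j + d                                   ≤⟨ j+d≤ ⟩
    ∣ S ∩ N G u ∣                           ≡⟨ ∣S∩N∣-split S u ⟩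
    ∣ S ∩ N F u ∣ + ∣ S ∩ N (G -E F) u ∣    ≤⟨ +-monoˡ-≤ _ (≤-trans (∣p∩q∣≤∣q∣ S (N F u)) (Δ≤d u)) ⟩
    d + ∣ S ∩ N (G -E F) u ∣                ≡⟨ +-comm d _ ⟩
    ∣ S ∩ N (G -E F) u ∣ + d                ∎)
    where open ≤-Reasoning

large-sets-expand : ∀ {n k} {G F : Graph n} → 2 ≤ k → SpanningSubgraph F G → MaxDeg≤ F (k ∸ 2) →
  β≥1 k G → (S : Subset n) → k ≤ ∣ S ∣ → Λ 2 (G -E F) S ≢ ⊤ → ∣ S ∣ ≤ ∣ Λ 2 (G -E F) S ∣
large-sets-expand {k = k} {G} {F} 2≤k F⊆G ΔF (_ , βᵏ) S k≤∣S∣ Λ²≢⊤ =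
  ≤-trans (βᵏ S k≤∣S∣ Λᵏ≢⊤) (p⊆q⇒∣p∣≤∣q∣ Λᵏ⊆Λ²)
  where
    Λᵏ⊆Λ² : Λ k G S ⊆ Λ 2 (G -E F) S
    Λᵏ⊆Λ² {u} u∈Λᵏ = ∈Λ⇐ (G -E F) 2 S (neighbours-after-removal {G = G} {F} F⊆G ΔF S
      (subst (_≤ ∣ S ∩ N G u ∣) (≡.sym (m+[n∸m]≡n 2≤k)) (∈Λ⇒ G k S u∈Λᵏ)))
    Λᵏ≢⊤ : Λ k G S ≢ ⊤
    Λᵏ≢⊤ Λᵏ≡⊤ = Λ²≢⊤ (⊆-antisym ⊆⊤ λ x∈⊤ → Λᵏ⊆Λ² (subst (_ ∈_) (≡.sym Λᵏ≡⊤) x∈⊤))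

common-neighbours-outside-k-set : ∀ {n k} {G : Graph n} → β≥1 k G → ∀ {a b} (X : Subset n) →
  a ∈ X → b ∈ X → ∣ X ∣ ≡ k → k ≤ ∣ (N G a ∩ N G b) ∩ ∁ X ∣
common-neighbours-outside-k-set {k = k} {G} (_ , βᵏ) {a} {b} X a∈X b∈X ∣X∣≡k = begin
  k                            ≡⟨ ∣X∣≡k ⟨
  ∣ X ∣                        ≤⟨ βᵏ X (≤-reflexive (≡.sym ∣X∣≡k)) Λᵏ≢⊤ ⟩
  ∣ Λ k G X ∣                  ≤⟨ p⊆q⇒∣p∣≤∣q∣ Λᵏ⊆ ⟩
  ∣ (N G a ∩ N G b) ∩ ∁ X ∣    ∎
  where
    open ≤-Reasoning
    X⊆N : ∀ {u} → u ∈ Λ k G X → X ⊆ N G u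
    X⊆N {u} u∈Λᵏ = ∣p∣≤∣p∩q∣⇒p⊆q (subst (_≤ ∣ X ∩ N G u ∣) (≡.sym ∣X∣≡k) (∈Λ⇒ G k X u∈Λᵏ))
    Λᵏ⊆ : Λ k G X ⊆ (N G a ∩ N G b) ∩ ∁ X
    Λᵏ⊆ u∈Λᵏ = x∈p∩q⁺ ( x∈p∩q⁺ (∈N-sym G (X⊆N u∈Λᵏ a∈X) , ∈N-sym G (X⊆N u∈Λᵏ b∈X))
                      , x∉p⇒x∈∁p (λ u∈X → ∉N-self G (X⊆N u∈Λᵏ u∈X)))
    Λᵏ≢⊤ : Λ k G X ≢ ⊤
    Λᵏ≢⊤ Λᵏ≡⊤ = ∉N-self G (X⊆N (subst (a ∈_) (≡.sym Λᵏ≡⊤) ∈⊤) a∈X)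

many-common-neighbours : ∀ {n k} {G : Graph n} → 2 ≤ k → β≥1 k G → ∀ a b → k + k ≤ ∣ N G a ∩ N G b ∣ + 2
many-common-neighbours {n} {k} {G} 2≤k βᵏ a b = by-cases (k ≤? ∣ A ∪ C ∣)
  where
    A C : Subset n
    A = ⁅ a ⁆ ∪ ⁅ b ⁆
    C = N G a ∩ N G b

    ∣A∣≤2 : ∣ A ∣ ≤ 2
    ∣A∣≤2 = ≤-trans (∣p∪q∣≤∣p∣+∣q∣ ⁅ a ⁆ ⁅ b ⁆) (≤-reflexive (cong₂ _+_ (∣⁅x⁆∣≡1 a) (∣⁅x⁆∣≡1 b)))

    a∈A⇒a∈X : ∀ {X} → A ⊆ X → a ∈ X
    a∈A⇒a∈X A⊆X = A⊆X (p⊆p∪q ⁅ b ⁆ (x∈⁅x⁆ a))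

    b∈A⇒b∈X : ∀ {X} → A ⊆ X → b ∈ X
    b∈A⇒b∈X A⊆X = A⊆X (q⊆p∪q ⁅ a ⁆ ⁅ b ⁆ (x∈⁅x⁆ b))

    by-cases : Dec (k ≤ ∣ A ∪ C ∣) → k + k ≤ ∣ C ∣ + 2
    by-cases (yes k≤∣A∪C∣)
      with X , A⊆X , X⊆A∪C , ∣X∣≡k ← intermediate-subset (p⊆p∪q C) (≤-trans ∣A∣≤2 2≤k) k≤∣A∪C∣
      = begin
        k + k                           ≤⟨ +-mono-≤ k≤∣C∩∁X∣ k≤∣C∩X∣+2 ⟩
        ∣ C ∩ ∁ X ∣ + (∣ C ∩ X ∣ + 2)   ≡⟨ +-assoc ∣ C ∩ ∁ X ∣ ∣ C ∩ X ∣ 2 ⟨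
        ∣ C ∩ ∁ X ∣ + ∣ C ∩ X ∣ + 2     ≡⟨ cong (_+ 2) (+-comm ∣ C ∩ ∁ X ∣ ∣ C ∩ X ∣) ⟩
        ∣ C ∩ X ∣ + ∣ C ∩ ∁ X ∣ + 2     ≡⟨ cong (_+ 2) (∣p∣≡∣p∩q∣+∣p∩∁q∣ C X) ⟨
        ∣ C ∣ + 2                       ∎
      where
        open ≤-Reasoning
        k≤∣C∩∁X∣ : k ≤ ∣ C ∩ ∁ X ∣
        k≤∣C∩∁X∣ = common-neighbours-outside-k-set {G = G} βᵏ X (a∈A⇒a∈X A⊆X) (b∈A⇒b∈X A⊆X) ∣X∣≡k
        X∩∁A⊆C∩X : X ∩ ∁ A ⊆ C ∩ X
        X∩∁A⊆C∩X x∈ with x∈X , x∈∁A ← x∈p∩q⁻ X (∁ A) x∈ | x∈p∪q⁻ A C (X⊆A∪C x∈X)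
        ... | inj₁ x∈A = contradiction x∈A (x∈∁p⇒x∉p x∈∁A)
        ... | inj₂ x∈C = x∈p∩q⁺ (x∈C , x∈X)
        k≤∣C∩X∣+2 : k ≤ ∣ C ∩ X ∣ + 2
        k≤∣C∩X∣+2 = begin
          k                     ≡⟨ ∣X∣≡k ⟨
          ∣ X ∣                 ≤⟨ ∣p∣≤∣p∩∁q∣+∣q∣ X A ⟩
          ∣ X ∩ ∁ A ∣ + ∣ A ∣   ≤⟨ +-mono-≤ (p⊆q⇒∣p∣≤∣q∣ X∩∁A⊆C∩X) ∣A∣≤2 ⟩
          ∣ C ∩ X ∣ + 2         ∎
    by-cases (no k≰∣A∪C∣)
      with X , A∪C⊆X , _ , ∣X∣≡k ← intermediate-subset ⊆⊤ (<⇒≤ (≰⇒> k≰∣A∪C∣))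
                                     (subst (k ≤_) (≡.sym (∣⊤∣≡n n)) (proj₁ βᵏ))
      = contradiction (≤-trans 2≤k (≤-trans k≤∣C∩∁X∣ ∣C∩∁X∣≤0)) λ ()
      where
        k≤∣C∩∁X∣ : k ≤ ∣ C ∩ ∁ X ∣
        k≤∣C∩∁X∣ = common-neighbours-outside-k-set {G = G} βᵏ X
                     (a∈A⇒a∈X (A∪C⊆X ∘ p⊆p∪q C)) (b∈A⇒b∈X (A∪C⊆X ∘ p⊆p∪q C)) ∣X∣≡k
        C∩∁X⊆∅ : C ∩ ∁ X ⊆ ∅
        C∩∁X⊆∅ x∈ with x∈C , x∈∁X ← x∈p∩q⁻ C (∁ X) x∈ =
          contradiction (A∪C⊆X (q⊆p∪q A C x∈C)) (x∈∁p⇒x∉p x∈∁X)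
        ∣C∩∁X∣≤0 : ∣ C ∩ ∁ X ∣ ≤ 0
        ∣C∩∁X∣≤0 = subst (∣ C ∩ ∁ X ∣ ≤_) (∣⊥∣≡0 n) (p⊆q⇒∣p∣≤∣q∣ C∩∁X⊆∅)

module _ {n} (G F : Graph n) (S : Subset n) where

  cherries : ℕ
  cherries = ∑[ a < n ] ∑[ b < n ] ([ distinctIn S a b ] * ∣ (N G a ∩ N G b) ∩ ∁ (Λ 2 (G -E F) S) ∣)

  cherries≤ : ∀ {k} → SpanningSubgraph F G → MaxDeg≤ F (k ∸ 2) → cherries ≤ ∣ S ∣ * (∣ S ∣ * (k ∸ 2))
  cherries≤ {k} F⊆G ΔF = begin
    cherries                                                      ≡⟨ cherry-count G S (∁ (Λ 2 (G -E F) S)) ⟩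
    ∑[ u < n ] ([ lookup (∁ (Λ 2 (G -E F) S)) u ] * (d u * (d u ∸ 1))) ≤⟨ sum-mono-≤ per-centre ⟩
    ∑[ u < n ] (∣ S ∣ * ∣ S ∩ N F u ∣)                            ≡⟨ *-distribˡ-sum ∣ S ∣ (λ u → ∣ S ∩ N F u ∣) ⟨
    ∣ S ∣ * ∑[ u < n ] ∣ S ∩ N F u ∣                              ≤⟨ *-monoʳ-≤ ∣ S ∣ (∑∣S∩N∣≤∣S∣*Δ F ΔF S) ⟩
    ∣ S ∣ * (∣ S ∣ * (k ∸ 2))                                      ∎
    where
      open ≤-Reasoning
      d : Fin n → ℕ
      d u = ∣ S ∩ N G u ∣
      d∸1≤ : ∀ {u} → u ∉ Λ 2 (G -E F) S → d u ∸ 1 ≤ ∣ S ∩ N F u ∣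
      d∸1≤ {u} u∉Λ² = begin
        d u ∸ 1                                  ≡⟨ cong (_∸ 1) (∣S∩N∣-split {G = G} {F} F⊆G S u) ⟩
        ∣ S ∩ N F u ∣ + ∣ S ∩ N (G -E F) u ∣ ∸ 1  ≤⟨ ∸-monoˡ-≤ 1 (+-monoʳ-≤ ∣ S ∩ N F u ∣ ∣S∩N′∣≤1) ⟩
        ∣ S ∩ N F u ∣ + 1 ∸ 1                    ≡⟨ m+n∸n≡m _ 1 ⟩
        ∣ S ∩ N F u ∣                            ∎
        where
          ∣S∩N′∣≤1 : ∣ S ∩ N (G -E F) u ∣ ≤ 1
          ∣S∩N′∣≤1 = s≤s⁻¹ (≰⇒> (u∉Λ² ∘ ∈Λ⇐ (G -E F) 2 S))
      per-centre : ∀ u → [ lookup (∁ (Λ 2 (G -E F) S)) u ] * (d u * (d u ∸ 1)) ≤ ∣ S ∣ * ∣ S ∩ N F u ∣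
      per-centre u = []*-≤ λ u∈∁Λ² →
        *-mono-≤ (∣p∩q∣≤∣p∣ S (N G u)) (d∸1≤ (x∈∁p⇒x∉p (T-lookup⇒∈ u∈∁Λ²)))

  ≤cherries : ∀ {k} → (∀ a b → k + k ≤ ∣ N G a ∩ N G b ∣ + 2) → ∣ Λ 2 (G -E F) S ∣ < ∣ S ∣ →
    ∣ S ∣ * (∣ S ∣ ∸ 1) * (k + k ∸ suc ∣ S ∣) ≤ cherries
  ≤cherries {k} common Λ²<S = begin
    ∣ S ∣ * (∣ S ∣ ∸ 1) * L                                  ≡⟨ cong (_* L) (∑∑-distinctIn S) ⟨
    (∑[ a < n ] ∑[ b < n ] [ distinctIn S a b ]) * L          ≡⟨ *-distribʳ-sum L (λ a → ∑[ b < n ] [ distinctIn S a b ]) ⟩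
    ∑[ a < n ] ((∑[ b < n ] [ distinctIn S a b ]) * L)        ≡⟨ sum-cong-≗ (λ a → *-distribʳ-sum L (λ b → [ distinctIn S a b ])) ⟩
    ∑[ a < n ] ∑[ b < n ] ([ distinctIn S a b ] * L)          ≤⟨ sum-mono-≤ (λ a → sum-mono-≤ λ b →
                                                                    *-monoʳ-≤ [ distinctIn S a b ] (per-pair a b)) ⟩
    cherries                                                 ∎
    where
      open ≤-Reasoning
      L : ℕ
      L = k + k ∸ suc ∣ S ∣
      per-pair : ∀ a b → L ≤ ∣ (N G a ∩ N G b) ∩ ∁ (Λ 2 (G -E F) S) ∣
      per-pair a b = subst (L ≤_) (m+n∸n≡m _ (suc ∣ S ∣)) (∸-monoˡ-≤ (suc ∣ S ∣) (begin
        k + k                                    ≤⟨ common a b ⟩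
        ∣ C ∣ + 2                                ≤⟨ +-monoˡ-≤ 2 (∣p∣≤∣p∩∁q∣+∣q∣ C Λ²) ⟩
        ∣ C ∩ ∁ Λ² ∣ + ∣ Λ² ∣ + 2                ≡⟨ +-assoc _ ∣ Λ² ∣ 2 ⟩
        ∣ C ∩ ∁ Λ² ∣ + (∣ Λ² ∣ + 2)              ≤⟨ +-monoʳ-≤ _ (subst (_≤ suc ∣ S ∣) (+-comm 2 ∣ Λ² ∣) (s≤s Λ²<S)) ⟩
        ∣ C ∩ ∁ Λ² ∣ + suc ∣ S ∣                 ∎))
        where
          C Λ² : Subset n
          C = N G a ∩ N G b
          Λ² = Λ 2 (G -E F) S

-- Writing k = s + 1 + e and cancelling s, the hypothesis reads (s - 1)(s + 1 + 2e) ≤ s(s - 1 + e).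
cherry-bounds-contradict : ∀ {s k} → 2 ≤ s → s < k → ¬ (s * (s ∸ 1) * (k + k ∸ suc s) ≤ s * (s * (k ∸ 2)))
cherry-bounds-contradict {suc (suc r)} (s≤s (s≤s z≤n)) s<k bound with m≤n⇒∃[o]m+o≡n s<k
... | e , refl = m+1+n≰m ((2 + r) * (1 + r + e)) (begin
  (2 + r) * (1 + r + e) + suc (r + r * e)      ≡⟨ identity r e ⟨
  (1 + r) * (e + (3 + r + e))                  ≡⟨ cong ((1 + r) *_) k+k∸[3+r]≡e+k ⟨
  (1 + r) * ((3 + r + e) + (3 + r + e) ∸ (3 + r))
                                               ≤⟨ *-cancelˡ-≤ (2 + r) (≤-trans (≤-reflexive (≡.sym (*-assoc (2 + r) (1 + r) _))) bound) ⟩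
  (2 + r) * (1 + r + e)                        ∎)
  where
    open ≤-Reasoning
    k+k∸[3+r]≡e+k : (3 + r + e) + (3 + r + e) ∸ (3 + r) ≡ e + (3 + r + e)
    k+k∸[3+r]≡e+k = ≡.trans (cong (_∸ (3 + r)) (+-assoc (3 + r) e _)) (m+n∸m≡n (3 + r) _)
    identity : ∀ r e → (1 + r) * (e + (3 + r + e)) ≡ (2 + r) * (1 + r + e) + suc (r + r * e)
    identity = solve-∀

small-sets-expand : ∀ {n k} {G F : Graph n} → SpanningSubgraph F G → MaxDeg≤ F (k ∸ 2) →
  (∀ a b → k + k ≤ ∣ N G a ∩ N G b ∣ + 2) →
  (S : Subset n) → 2 ≤ ∣ S ∣ → ∣ S ∣ < k → ∣ S ∣ ≤ ∣ Λ 2 (G -E F) S ∣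
small-sets-expand {k = k} {G} {F} F⊆G ΔF common S 2≤∣S∣ ∣S∣<k with ∣ S ∣ ≤? ∣ Λ 2 (G -E F) S ∣
... | yes ∣S∣≤∣Λ²∣ = ∣S∣≤∣Λ²∣
... | no  ∣S∣≰∣Λ²∣ = contradiction
  (≤-trans (≤cherries G F S {k} common (≰⇒> ∣S∣≰∣Λ²∣)) (cherries≤ G F S {k} F⊆G ΔF))
  (cherry-bounds-contradict 2≤∣S∣ ∣S∣<k)

lemma3p5 : (k : ℕ) → 2 ≤ k → {n : ℕ} → (G F : Graph n) →
    SpanningSubgraph F G → β≥1 k G → MaxDeg≤ F (k ∸ 2) →
    β≥1 2 (G -E F)
lemma3p5 k 2≤k G F F⊆G βᵏ ΔF = ≤-trans 2≤k (proj₁ βᵏ) , expands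
  where
    expands : ∀ S → 2 ≤ ∣ S ∣ → Λ 2 (G -E F) S ≢ ⊤ → ∣ S ∣ ≤ ∣ Λ 2 (G -E F) S ∣
    expands S 2≤∣S∣ Λ²≢⊤ with k ≤? ∣ S ∣
    ... | yes k≤∣S∣ = large-sets-expand {G = G} {F} 2≤k F⊆G ΔF βᵏ S k≤∣S∣ Λ²≢⊤
    ... | no  k≰∣S∣ =
      small-sets-expand {G = G} {F} F⊆G ΔF (many-common-neighbours {G = G} 2≤k βᵏ) S 2≤∣S∣ (≰⇒> k≰∣S∣)
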